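{- Let $P$ be a path of order $m\geq 2$ and $C$ a cycle of order $n\geq 3$. Then $$\operatorname{dem}(P\Box C)=\begin{cases} n & \text{if } n\geq 2m+1,\\ 2m & \text{if } n< 2m+1.\end{cases}$$
   Context: For a graph $X$, a set $M\subseteq V(X)$ and an edge $e\in E(X)$, $P_X(M,e)$ is the set of pairs $(x,y)$ with $x\in M$, $y\in V(X)$ such that $d_X(x,y)\neq d_{X-e}(x,y)$. An edge $e$ is monitored by $x$ if $P_X(\{x\},e)\ne\emptyset$. A distance-edge-monitoring set is a set $M$ such that every edge is monitored by some vertex of $M$; $\operatorname{dem}(X)$ is the minimum size of such a set. $\Box$ denotes the Cartesian product of graphs. -}

module Defs where

open import Data.Nat using (ℕ; zero; suc; _+_; _*_; _≤_; _<_; _%_)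
open import Data.Fin using (Fin; toℕ)
open import Data.Maybe using (Maybe; just; nothing)
open import Data.List using (List; length)
open import Data.List.Membership.Propositional using (_∈_)
open import Data.List.Relation.Unary.Unique.Propositional using (Unique)
open import Data.Product using (Σ; ∃; ∃-syntax; _×_; _,_)
open import Data.Sum using (_⊎_)
open import Relation.Nullary using (¬_)
open import Relation.Binary.PropositionalEquality using (_≡_; _≢_)

record Graph : Set₁ where
  field
    V   : Set
    Adj : V → V → Set
open Graph public

data Walk (X : Graph) : V X → V X → ℕ → Set where
  here : ∀ {x} → Walk X x x 0
  step : ∀ {x y z ℓ} → Adj X x y → Walk X y z ℓ → Walk X x z (suc ℓ)

-- Dist X x y d : the distance d_X(x,y) is d, where 'nothing' means infinite
-- (no walk from x to y) and 'just k' means the shortest walk has length k.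
data Dist (X : Graph) (x y : V X) : Maybe ℕ → Set where
  finite   : ∀ {k} → Walk X x y k → (∀ {ℓ} → Walk X x y ℓ → k ≤ ℓ) → Dist X x y (just k)
  infinite : (∀ {ℓ} → ¬ Walk X x y ℓ) → Dist X x y nothing

_-edge_ : (X : Graph) → V X × V X → Graph
V (X -edge e) = V X
Adj (X -edge (u , v)) a b = Adj X a b × ¬ ((a ≡ u × b ≡ v) ⊎ (a ≡ v × b ≡ u))

DistChanges : (X : Graph) → V X × V X → V X → V X → Set
DistChanges X e x y =
  ∃[ a ] ∃[ b ] (Dist X x y a × Dist (X -edge e) x y b × a ≢ b)

MonitoredBy : (X : Graph) → V X × V X → V X → Set
MonitoredBy X e x = ∃[ y ] DistChanges X e x y

IsDEM : (X : Graph) → List (V X) → Set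
IsDEM X M = ∀ u v → Adj X u v → ∃[ x ] (x ∈ M × MonitoredBy X (u , v) x)

DemIs : (X : Graph) → ℕ → Set
DemIs X k =
  (∃[ M ] (Unique M × IsDEM X M × length M ≡ k))
  × (∀ (M : List (V X)) → Unique M → IsDEM X M → k ≤ length M)

PathG : ℕ → Graph
V (PathG m) = Fin m
Adj (PathG m) i j = (suc (toℕ i) ≡ toℕ j) ⊎ (suc (toℕ j) ≡ toℕ i)

CycleG : (n : ℕ) → Graph
V (CycleG n) = Fin n
Adj (CycleG n) i j = (suc (toℕ i) % suc (Data.Nat.pred n) ≡ toℕ j)
                   ⊎ (suc (toℕ j) % suc (Data.Nat.pred n) ≡ toℕ i)

_□_ : Graph → Graph → Graph
V (X □ Y) = V X × V Y
Adj (X □ Y) (a , b) (c , d) = (Adj X a c × b ≡ d) ⊎ (a ≡ c × Adj Y b d)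

-- Seen from x = (a , b), distances in P □ C are path distances from a plus cycle distances from b.
-- An edge is monitored by x only if one endpoint d is farther from x than the other one c and c is
-- the only neighbour of d one step closer to x; conversely such an edge is monitored, as it lies on
-- a 4-cycle. Hence x monitors path edges only in its own column, cycle edges only in its own row,
-- and in its row it misses the edge(s) at the vertex antipodal to b. So a monitoring set meets
-- every column and has two vertices in every row: dem ≥ max(n, 2m). Two vertices of a row whose
-- columns differ by ⌊n/2⌋ monitor the whole row, so taking the columns i and i + ⌊n/2⌋ in each row
-- i, while meeting every column, gives a monitoring set of size n if n ≥ 2m + 1 and 2m otherwise.

module Submission where

open import Defs
open import Data.Nat
  using (ℕ; zero; suc; _+_; _*_; _∸_; _⊓_; _%_; _≤_; _<_; _<?_; s≤s; z≤n; ∣_-_∣; ⌊_/2⌋; ⌈_/2⌉; NonZero)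
import Data.Nat as ℕ
open import Data.Nat.Properties hiding (_≟_)
open import Data.Nat.DivMod using (_mod_; %-distribˡ-+; m%n%n≡m%n; [m+n]%n≡m%n; m<n⇒m%n≡m; n%n≡0; m%n<n)
open import Algebra.Properties.CommutativeSemigroup +-commutativeSemigroup using (interchange)
open import Data.Fin using (Fin; toℕ; fromℕ; fromℕ<; inject₁; splitAt; join)
import Data.Fin as Fin
open import Data.Fin.Properties
  using (¬∀⟶∃¬-smallest; toℕ-fromℕ; toℕ-fromℕ<; toℕ-inject; toℕ-inject₁; toℕ<n; toℕ-injective;
         injective⇒≤; join-splitAt; splitAt-join)
import Data.Fin.Properties as Fin
open import Data.List using (List; length; tabulate; lookup)
open import Data.List.Properties using (length-tabulate)
open import Data.List.Membership.Propositional using (_∈_)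
open import Data.List.Membership.Propositional.Properties using (∈-tabulate⁺)
open import Data.List.Relation.Unary.Any using (index)
open import Data.List.Relation.Unary.Any.Properties using (lookup-index)
open import Data.List.Relation.Unary.Unique.Propositional.Properties using (tabulate⁺)
open import Data.Maybe using (just)
open import Data.Maybe.Properties using (just-injective)
open import Data.Product
open import Data.Product.Properties using (≡-dec)
open import Data.Sum using (_⊎_; inj₁; inj₂)
import Data.Sum as Sum
open import Data.Empty using (⊥; ⊥-elim)
open import Function using (_∘_)
open import Relation.Nullary
open import Relation.Unary using () renaming (Decidable to Decidable₁)
open import Relation.Binary.Definitions using (Decidable; DecidableEquality; Symmetric; tri<; tri≈; tri>)
open import Relation.Binary.PropositionalEquality

-- Walks and distances

module _ {X : Graph} where

  _∷ʳ_ : ∀ {x y z ℓ} → Walk X x y ℓ → Adj X y z → Walk X x z (suc ℓ)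
  here     ∷ʳ a = step a here
  step b w ∷ʳ a = step b (w ∷ʳ a)

  unsnoc : ∀ {x z ℓ} → Walk X x z (suc ℓ) → ∃ λ y → Walk X x y ℓ × Adj X y z
  unsnoc (step a here)       = _ , here , a
  unsnoc (step a (step b w)) with unsnoc (step b w)
  ... | y , w′ , c = y , step a w′ , c

  _++ᵂ_ : ∀ {x y z ℓ ℓ′} → Walk X x y ℓ → Walk X y z ℓ′ → Walk X x z (ℓ + ℓ′)
  here     ++ᵂ w′ = w′
  step a w ++ᵂ w′ = step a (w ++ᵂ w′)

  Dist-functional : ∀ {x y a b} → Dist X x y a → Dist X x y b → a ≡ b
  Dist-functional (finite w min) (finite w′ min′) = cong just (≤-antisym (min w′) (min′ w))
  Dist-functional (finite w _)   (infinite ∄w)    = ⊥-elim (∄w w)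
  Dist-functional (infinite ∄w)  (finite w _)     = ⊥-elim (∄w w)
  Dist-functional (infinite _)   (infinite _)     = refl

Lipschitz : (X : Graph) → (V X → ℕ) → Set
Lipschitz X f = ∀ {p q} → Adj X p q → f q ≤ suc (f p)

Lipschitz⇒≤+length : ∀ {X f} → Lipschitz X f → ∀ {x y ℓ} → Walk X x y ℓ → f y ≤ ℓ + f x
Lipschitz⇒≤+length lip here = ≤-refl
Lipschitz⇒≤+length {f = f} lip {x} {y} (step {y = z} {ℓ = ℓ} a w) = begin
  f y              ≤⟨ Lipschitz⇒≤+length lip w ⟩
  ℓ + f z          ≤⟨ +-monoʳ-≤ ℓ (lip a) ⟩
  ℓ + suc (f x)    ≡⟨ +-suc ℓ (f x) ⟩
  suc ℓ + f x      ∎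
  where open ≤-Reasoning

Removed : ∀ {A : Set} → A × A → A → A → Set
Removed (u , v) a b = (a ≡ u × b ≡ v) ⊎ (a ≡ v × b ≡ u)

module _ {A : Set} {c d z z′ : A} where

  ¬Removed-source : z ≢ c → z ≢ d → ¬ Removed (c , d) z z′
  ¬Removed-source z≢c _ (inj₁ (z≡c , _)) = z≢c z≡c
  ¬Removed-source _ z≢d (inj₂ (z≡d , _)) = z≢d z≡d

  ¬Removed-target : z′ ≢ c → z′ ≢ d → ¬ Removed (c , d) z z′
  ¬Removed-target _ z′≢d (inj₁ (_ , z′≡d)) = z′≢d z′≡d
  ¬Removed-target z′≢c _ (inj₂ (_ , z′≡c)) = z′≢c z′≡c

module _ {X : Graph} where

  forget : ∀ {u v x y ℓ} → Walk (X -edge (u , v)) x y ℓ → Walk X x y ℓ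
  forget here             = here
  forget (step (a , _) w) = step a (forget w)

  deletion-swapᵂ : ∀ {u v x y ℓ} → Walk (X -edge (u , v)) x y ℓ → Walk (X -edge (v , u)) x y ℓ
  deletion-swapᵂ here                = here
  deletion-swapᵂ (step (a , ¬rem) w) = step (a , ¬rem ∘ Sum.swap) (deletion-swapᵂ w)

  Dist-deletion-swap : ∀ {u v x y d} → Dist (X -edge (u , v)) x y d → Dist (X -edge (v , u)) x y d
  Dist-deletion-swap (finite w min) = finite (deletion-swapᵂ w) (min ∘ deletion-swapᵂ)
  Dist-deletion-swap (infinite ∄w)  = infinite (∄w ∘ deletion-swapᵂ)

  MonitoredBy-swap : ∀ {u v x} → MonitoredBy X (u , v) x → MonitoredBy X (v , u) x
  MonitoredBy-swap (y , a , b , da , db , a≢b) = y , a , b , da , Dist-deletion-swap db , a≢b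

-- Exhibiting a distance in X − e, where no labelling is at hand, means finding a shortest walk.
record Searchable (X : Graph) : Set₁ where
  field
    _≟_  : DecidableEquality (V X)
    adj? : Decidable (Adj X)
    any? : (P : V X → Set) → Decidable₁ P → Dec (∃ P)

  walk? : ∀ ℓ x y → Dec (Walk X x y ℓ)
  walk? zero x y with x ≟ y
  ... | yes refl = yes here
  ... | no x≢y   = no λ { here → x≢y refl }
  walk? (suc ℓ) x y with any? (λ z → Adj X x z × Walk X z y ℓ) (λ z → adj? x z ×-dec walk? ℓ z y)
  ... | yes (_ , a , w) = yes (step a w)
  ... | no ∄z           = no λ { (step a w) → ∄z (_ , a , w) }

  walk⇒Dist : ∀ {x y ℓ} → Walk X x y ℓ → ∃ λ k → Dist X x y (just k)
  walk⇒Dist {x} {y} {ℓ} w with ¬∀⟶∃¬-smallest (suc ℓ) (λ i → ¬ Walk X x y (toℕ i))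
                                 (λ i → ¬? (walk? (toℕ i) x y))
                                 (λ none → none (fromℕ ℓ) (subst (Walk X x y) (sym (toℕ-fromℕ ℓ)) w))
  ... | i , ¬¬w , shorter = toℕ i , finite (decidable-stable (walk? (toℕ i) x y) ¬¬w) minimal
    where
    minimal : ∀ {ℓ′} → Walk X x y ℓ′ → toℕ i ≤ ℓ′
    minimal {ℓ′} w′ = ≮⇒≥ λ ℓ′<i →
      shorter (fromℕ< ℓ′<i) (subst (Walk X x y) (sym (trans (toℕ-inject _) (toℕ-fromℕ< ℓ′<i))) w′)

  deletion-searchable : ∀ e → Searchable (X -edge e)
  deletion-searchable (u , v) = record
    { _≟_ = _≟_
    ; adj? = λ a b → adj? a b ×-dec ¬? (((a ≟ u) ×-dec (b ≟ v)) ⊎-dec ((a ≟ v) ×-dec (b ≟ u)))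
    ; any? = any?
    }

lift-below : ∀ {X f} → Lipschitz X f → ∀ {c d z y ℓ} → f z + ℓ < f d → Walk X z y ℓ →
             Walk (X -edge (c , d)) z y ℓ
lift-below lip bound here = here
lift-below {f = f} lip {c} {d} {z} {ℓ = suc ℓ} bound (step {y = z′} a w) =
  step (a , avoid) (lift-below lip bound′ w)
  where
  bound′ : f z′ + ℓ < f d
  bound′ = ≤-<-trans (+-monoˡ-≤ ℓ (lip a)) (subst (_< f d) (+-suc (f z) ℓ) bound)
  avoid : ¬ Removed (c , d) z z′
  avoid (inj₁ (_ , refl)) = m+n≮m (f d) ℓ bound′
  avoid (inj₂ (refl , _)) = m+n≮m (f d) (suc ℓ) bound

-- Distance labellings and monitored edges

IsParent : (X : Graph) → (V X → ℕ) → V X → V X → Set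
IsParent X f p y = Adj X p y × suc (f p) ≡ f y

SoleParent : (X : Graph) → (V X → ℕ) → V X → V X → Set
SoleParent X f c d = IsParent X f c d × (∀ {w} → IsParent X f w d → w ≡ c)

SoleParentEdge : (X : Graph) → (V X → ℕ) → V X → V X → Set
SoleParentEdge X f c d = SoleParent X f c d ⊎ SoleParent X f d c

record IsDistanceLabelling (X : Graph) (x : V X) (f : V X → ℕ) : Set where
  field
    lipschitz : Lipschitz X f
    root      : f x ≡ 0
    parent    : ∀ {y} → y ≢ x → ∃ λ p → IsParent X f p y

module Labelling {X : Graph} (S : Searchable X) {x : V X} {f : V X → ℕ}
                 (L : IsDistanceLabelling X x f) where
  open Searchable S
  open IsDistanceLabelling L

  geodesic : ∀ y → Walk X x y (f y)
  geodesic y = go (f y) y refl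
    where
    go : ∀ k y → f y ≡ k → Walk X x y k
    go k y fy≡k with y ≟ x
    go k _ fx≡k       | yes refl = subst (Walk X x x) (trans (sym root) fx≡k) here
    go zero y fy≡0    | no y≢x   = ⊥-elim (1+n≢0 (trans (proj₂ (proj₂ (parent y≢x))) fy≡0))
    go (suc k) y fy≡k | no y≢x with parent y≢x
    ... | p , a , fp+1≡fy = go k p (suc-injective (trans fp+1≡fy fy≡k)) ∷ʳ a

  Dist-labelling : ∀ y → Dist X x y (just (f y))
  Dist-labelling y = finite (geodesic y) λ w →
    subst (f y ≤_) (trans (cong (_ +_) root) (+-identityʳ _)) (Lipschitz⇒≤+length lipschitz w)

module Monitoring {X : Graph} (S : Searchable X) {x : V X} {f : V X → ℕ}
                  (L : IsDistanceLabelling X x f) where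
  open Searchable S
  open IsDistanceLabelling L
  open Labelling S L

  parents-survive⇒¬monitored : ∀ {e} → (∀ {y} → y ≢ x → ∃ λ p → IsParent (X -edge e) f p y) →
                               ¬ MonitoredBy X e x
  parents-survive⇒¬monitored {e} parent′ (y , _ , _ , dX , dY , dX≢dY) =
    dX≢dY (trans (Dist-functional dX (Dist-labelling y))
                 (Dist-functional (Labelling.Dist-labelling (deletion-searchable e) L′ y) dY))
    where
    L′ : IsDistanceLabelling (X -edge e) x f
    L′ = record { lipschitz = lipschitz ∘ proj₁ ; root = root ; parent = parent′ }

  level⇒¬monitored : ∀ {c d} → f c ≡ f d → ¬ MonitoredBy X (c , d) x
  level⇒¬monitored {c} {d} fc≡fd = parents-survive⇒¬monitored parent′
    where
    parent′ : ∀ {y} → y ≢ x → ∃ λ p → IsParent (X -edge (c , d)) f p y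
    parent′ y≢x with parent y≢x
    ... | p , a , fp+1≡fy = p , (a , avoid) , fp+1≡fy
      where
      avoid : ¬ Removed (c , d) p _
      avoid (inj₁ (refl , refl)) = 1+n≢n (trans fp+1≡fy (sym fc≡fd))
      avoid (inj₂ (refl , refl)) = 1+n≢n (trans fp+1≡fy fc≡fd)

  second-parent⇒¬monitored : ∀ {c d w} → suc (f c) ≡ f d → IsParent X f w d → w ≢ c →
                             ¬ MonitoredBy X (c , d) x
  second-parent⇒¬monitored {c} {d} {w} fc+1≡fd (aw , fw+1≡fd) w≢c = parents-survive⇒¬monitored parent′
    where
    parent′ : ∀ {y} → y ≢ x → ∃ λ p → IsParent (X -edge (c , d)) f p y
    parent′ {y} y≢x with y ≟ d
    ... | yes refl = w , (aw , avoid) , fw+1≡fd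
      where
      avoid : ¬ Removed (c , d) w d
      avoid (inj₁ (w≡c , _)) = w≢c w≡c
      avoid (inj₂ (refl , _)) = 1+n≢n fw+1≡fd
    ... | no y≢d with parent y≢x
    ...   | p , a , fp+1≡fy = p , (a , avoid) , fp+1≡fy
      where
      avoid : ¬ Removed (c , d) p y
      avoid (inj₁ (_ , y≡d))     = y≢d y≡d
      avoid (inj₂ (refl , refl)) = <-asym (≤-reflexive fc+1≡fd) (≤-reflexive fp+1≡fy)

  sole-parent⇒monitored : ∀ {c d ℓ} → SoleParent X f c d → Walk (X -edge (c , d)) c d ℓ →
                          MonitoredBy X (c , d) x
  sole-parent⇒monitored {c} {d} ((_ , fc+1≡fd) , sole) detour with
    Searchable.walk⇒Dist (deletion-searchable (c , d))
      (lift-below lipschitz (subst (λ z → z + f c < f d) (sym root) (≤-reflexive fc+1≡fd))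
                  (geodesic c) ++ᵂ detour)
  ... | k , D@(finite shortest _) = d , just (f d) , just k , Dist-labelling d , D , λ fd≡k →
    no-geodesic (subst (Walk (X -edge (c , d)) x d) (trans (sym (just-injective fd≡k)) (sym fc+1≡fd)) shortest)
    where
    -- Such a walk would have to enter d from a parent other than c.
    no-geodesic : ¬ Walk (X -edge (c , d)) x d (suc (f c))
    no-geodesic w with unsnoc w
    ... | w′ , prefix , (a , avoid) = avoid (inj₁ (sole (a , fw′+1≡fd) , refl))
      where
      fw′≤fc : f w′ ≤ f c
      fw′≤fc = subst (f w′ ≤_) (trans (cong (f c +_) root) (+-identityʳ (f c)))
                     (Lipschitz⇒≤+length lipschitz (forget prefix))
      fw′+1≡fd : suc (f w′) ≡ f d
      fw′+1≡fd = ≤-antisym (≤-trans (s≤s fw′≤fc) (≤-reflexive fc+1≡fd)) (lipschitz a)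

  parent-edge⇒sole-parent : ∀ {c d} → IsParent X f c d → MonitoredBy X (c , d) x →
                            SoleParent X f c d
  parent-edge⇒sole-parent {c} {d} par@(_ , fc+1≡fd) mon = par , λ {w} par′ →
    decidable-stable (w ≟ c) λ w≢c → second-parent⇒¬monitored fc+1≡fd par′ w≢c mon

  monitored⇒sole-parent : Symmetric (Adj X) → ∀ {c d} → Adj X c d → MonitoredBy X (c , d) x →
                          SoleParentEdge X f c d
  monitored⇒sole-parent symmetric {c} {d} a mon with <-cmp (f c) (f d)
  ... | tri≈ _ fc≡fd _ = ⊥-elim (level⇒¬monitored fc≡fd mon)
  ... | tri< fc<fd _ _ =
    inj₁ (parent-edge⇒sole-parent (a , ≤-antisym fc<fd (lipschitz a)) mon)
  ... | tri> _ _ fd<fc = inj₂ (parent-edge⇒sole-parent (symmetric a , ≤-antisym fd<fc (lipschitz (symmetric a)))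
                                                       (MonitoredBy-swap mon))



record Automorphism (X : Graph) : Set where
  field
    to       : V X → V X
    from     : V X → V X
    from-to  : ∀ x → from (to x) ≡ x
    to-from  : ∀ x → to (from x) ≡ x
    to-adj   : ∀ {p q} → Adj X p q → Adj X (to p) (to q)
    from-adj : ∀ {p q} → Adj X p q → Adj X (from p) (from q)

  to-injective : ∀ {x y} → to x ≡ to y → x ≡ y
  to-injective {x} {y} e = trans (sym (from-to x)) (trans (cong from e) (from-to y))

  to-adj⁻ : ∀ {p q} → Adj X (to p) (to q) → Adj X p q
  to-adj⁻ {p} {q} a = subst₂ (Adj X) (from-to p) (from-to q) (from-adj a)

  from-adj⁻ : ∀ {p q} → Adj X p (to q) → Adj X (from p) q
  from-adj⁻ {p} a = to-adj⁻ (subst (λ z → Adj X z _) (sym (to-from p)) a)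

module _ {X : Graph} (φ : Automorphism X) where
  open Automorphism φ

  labelling-∘ : ∀ {x₀ x f} → to x ≡ x₀ → IsDistanceLabelling X x₀ f →
                IsDistanceLabelling X x (f ∘ to)
  labelling-∘ {x₀} {x} {f} tx≡x₀ L = record
    { lipschitz = lipschitz ∘ to-adj ; root = trans (cong f tx≡x₀) root ; parent = parent′ }
    where
    open IsDistanceLabelling L
    parent′ : ∀ {y} → y ≢ x → ∃ λ p → IsParent X (f ∘ to) p y
    parent′ {y} y≢x with parent (λ ty≡x₀ → y≢x (to-injective (trans ty≡x₀ (sym tx≡x₀))))
    ... | p , a , e = from p , from-adj⁻ a , trans (cong (suc ∘ f) (to-from p)) e

  sole-parent-∘ : ∀ {f c d} → SoleParent X f (to c) (to d) → SoleParent X (f ∘ to) c d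
  sole-parent-∘ ((a , e) , sole) = (to-adj⁻ a , e) , λ (aw , ew) → to-injective (sole (to-adj aw , ew))

  sole-parent-∘⁻ : ∀ {f c d} → SoleParent X (f ∘ to) c d → SoleParent X f (to c) (to d)
  sole-parent-∘⁻ {f} {c} ((a , e) , sole) = (to-adj a , e) , λ {w} (aw , ew) →
    trans (sym (to-from w)) (cong to (sole (from-adj⁻ aw , trans (cong (suc ∘ f) (to-from w)) ew)))

-- Cartesian products

_⊕_ : ∀ {A B : Set} → (A → ℕ) → (B → ℕ) → A × B → ℕ
(f ⊕ g) (p , q) = f p + g q

module _ {X Y : Graph} where

  □-symmetric : Symmetric (Adj X) → Symmetric (Adj Y) → Symmetric (Adj (X □ Y))
  □-symmetric symX symY (inj₁ (a , refl)) = inj₁ (symX a , refl)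
  □-symmetric symX symY (inj₂ (refl , a)) = inj₂ (refl , symY a)

  □-searchable : Searchable X → Searchable Y → Searchable (X □ Y)
  □-searchable SX SY = record
    { _≟_  = ≡-dec SX._≟_ SY._≟_
    ; adj? = λ { (p , q) (p′ , q′) →
               (SX.adj? p p′ ×-dec (q SY.≟ q′)) ⊎-dec ((p SX.≟ p′) ×-dec SY.adj? q q′) }
    ; any? = any?
    }
    where
    module SX = Searchable SX
    module SY = Searchable SY
    any? : (P : V X × V Y → Set) → Decidable₁ P → Dec (∃ P)
    any? P P? with SX.any? (λ p → ∃ λ q → P (p , q))
                           (λ p → SY.any? (λ q → P (p , q)) (λ q → P? (p , q)))
    ... | yes (p , q , pq) = yes ((p , q) , pq)
    ... | no ∄pq           = no λ { ((p , q) , pq) → ∄pq (p , q , pq) }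

  □-labelling : DecidableEquality (V X) → ∀ {a b f g} →
                IsDistanceLabelling X a f → IsDistanceLabelling Y b g →
                IsDistanceLabelling (X □ Y) (a , b) (f ⊕ g)
  □-labelling _≟_ {a} {b} {f} {g} LX LY = record
    { lipschitz = lipschitz ; root = cong₂ _+_ LX.root LY.root ; parent = parent }
    where
    module LX = IsDistanceLabelling LX
    module LY = IsDistanceLabelling LY
    lipschitz : Lipschitz (X □ Y) (f ⊕ g)
    lipschitz (inj₁ (a , refl)) = +-monoˡ-≤ _ (LX.lipschitz a)
    lipschitz {p , q} {_ , q′} (inj₂ (refl , a)) =
      subst (f p + g q′ ≤_) (+-suc (f p) (g q)) (+-monoʳ-≤ (f p) (LY.lipschitz a))
    parent : ∀ {y} → y ≢ (a , b) → ∃ λ z → IsParent (X □ Y) (f ⊕ g) z y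
    parent {p , q} pq≢ab with p ≟ a
    ... | no p≢a with LX.parent p≢a
    ...   | p′ , a , e = (p′ , q) , inj₁ (a , refl) , cong (_+ g q) e
    parent {p , q} pq≢ab | yes refl with LY.parent (λ q≡b → pq≢ab (cong (p ,_) q≡b))
    ...   | q′ , a , e = (p , q′) , inj₂ (refl , a) , trans (sym (+-suc (f p) (g q′))) (cong (f p +_) e)

module _ {X Y : Graph} where

  detourˣ : ∀ {p p′ q q′} → Adj X p p′ → Adj Y q q′ → Adj Y q′ q → q ≢ q′ →
            Walk ((X □ Y) -edge ((p , q) , (p′ , q))) (p , q) (p′ , q) 3
  detourˣ {q = q} {q′} ap aq aq′ q≢q′ =
    step (inj₂ (refl , aq) , ¬Removed-target off off)
    (step (inj₁ (ap , refl) , ¬Removed-source off off)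
    (step (inj₂ (refl , aq′) , ¬Removed-source off off) here))
    where
    off : ∀ {r r′} → (r , q′) ≢ (r′ , q)
    off e = q≢q′ (sym (cong proj₂ e))

  detourʸ : ∀ {p p′ q q′} → Adj Y q q′ → Adj X p p′ → Adj X p′ p → p ≢ p′ →
            Walk ((X □ Y) -edge ((p , q) , (p , q′))) (p , q) (p , q′) 3
  detourʸ {p = p} {p′} aq ap ap′ p≢p′ =
    step (inj₁ (ap , refl) , ¬Removed-target off off)
    (step (inj₂ (refl , aq) , ¬Removed-source off off)
    (step (inj₁ (ap′ , refl) , ¬Removed-source off off) here))
    where
    off : ∀ {r r′} → (p′ , r) ≢ (p , r′)
    off e = p≢p′ (sym (cong proj₁ e))

module Product {X Y : Graph} (SX : Searchable X) (SY : Searchable Y)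
               (symX : Symmetric (Adj X)) (symY : Symmetric (Adj Y))
               {a b f g} (LX : IsDistanceLabelling X a f) (LY : IsDistanceLabelling Y b g) where
  private
    module SX = Searchable SX
    module SY = Searchable SY
    module LX = IsDistanceLabelling LX
    module LY = IsDistanceLabelling LY
    open Monitoring (□-searchable SX SY) (□-labelling SX._≟_ LX LY)
      using (monitored⇒sole-parent; sole-parent⇒monitored)

  parentˣ-lift : ∀ {p p′ q} → IsParent X f p p′ → IsParent (X □ Y) (f ⊕ g) (p , q) (p′ , q)
  parentˣ-lift {q = q} (adj , e) = inj₁ (adj , refl) , cong (_+ g q) e

  parentʸ-lift : ∀ {p q q′} → IsParent Y g q q′ → IsParent (X □ Y) (f ⊕ g) (p , q) (p , q′)
  parentʸ-lift {p} {q} (adj , e) = inj₂ (refl , adj) , trans (sym (+-suc (f p) (g q))) (cong (f p +_) e)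

  sole-parentˣ⇒root-column : ∀ {p p′ q} → SoleParent (X □ Y) (f ⊕ g) (p , q) (p′ , q) → q ≡ b
  sole-parentˣ⇒root-column {q = q} (_ , sole) = decidable-stable (q SY.≟ b) λ q≢b →
    let q* , par = LY.parent q≢b in
    1+n≢n (subst (λ z → suc (g z) ≡ g q) (cong proj₂ (sole (parentʸ-lift par))) (proj₂ par))

  sole-parentʸ⇒root-row : ∀ {p q q′} → SoleParent (X □ Y) (f ⊕ g) (p , q) (p , q′) → p ≡ a
  sole-parentʸ⇒root-row {p} (_ , sole) = decidable-stable (p SX.≟ a) λ p≢a →
    let p* , par = LX.parent p≢a in
    1+n≢n (subst (λ z → suc (f z) ≡ f p) (cong proj₁ (sole (parentˣ-lift par))) (proj₂ par))

  sole-parentˣ-lift : ∀ {p p′} → SoleParent X f p p′ → SoleParent (X □ Y) (f ⊕ g) (p , b) (p′ , b)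
  sole-parentˣ-lift {p} {p′} (par , sole) = parentˣ-lift par , sole′
    where
    sole′ : ∀ {w} → IsParent (X □ Y) (f ⊕ g) w (p′ , b) → w ≡ (p , b)
    sole′ (inj₁ (adj , refl) , e) = cong (_, b) (sole (adj , +-cancelʳ-≡ (g b) _ _ e))
    sole′ {_ , w} (inj₂ (refl , _) , e) =
      ⊥-elim (m+n≮m (f p′) (g w)
        (≤-reflexive (trans e (trans (cong (f p′ +_) LY.root) (+-identityʳ (f p′))))))

  sole-parentʸ-lift : ∀ {q q′} → SoleParent Y g q q′ → SoleParent (X □ Y) (f ⊕ g) (a , q) (a , q′)
  sole-parentʸ-lift {q} {q′} (par , sole) = parentʸ-lift par , sole′
    where
    sole′ : ∀ {w} → IsParent (X □ Y) (f ⊕ g) w (a , q′) → w ≡ (a , q)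
    sole′ (inj₂ (refl , adj) , e) = cong (a ,_) (sole (adj , +-cancelˡ-≡ (f a) _ _ (trans (+-suc (f a) _) e)))
    sole′ {w , _} (inj₁ (_ , refl) , e) =
      ⊥-elim (m+n≮n (f w) (g q′) (≤-reflexive (trans e (cong (_+ g q′) LX.root))))

  sole-parentʸ-proj : ∀ {p q q′} → SoleParent (X □ Y) (f ⊕ g) (p , q) (p , q′) → SoleParent Y g q q′
  sole-parentʸ-proj {p} {q} (par , sole) = parent′ par , λ par′ → cong proj₂ (sole (parentʸ-lift par′))
    where
    parent′ : ∀ {q′} → IsParent (X □ Y) (f ⊕ g) (p , q) (p , q′) → IsParent Y g q q′
    parent′ (inj₁ (_ , refl) , e) = ⊥-elim (1+n≢n e)
    parent′ (inj₂ (_ , adj) , e)  = adj , +-cancelˡ-≡ (f p) _ _ (trans (+-suc (f p) (g q)) e)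

  monitorsˣ⇒root-column : ∀ {p p′ q} → Adj X p p′ →
                          MonitoredBy (X □ Y) ((p , q) , (p′ , q)) (a , b) → q ≡ b
  monitorsˣ⇒root-column adj mon = Sum.[ sole-parentˣ⇒root-column , sole-parentˣ⇒root-column ]
    (monitored⇒sole-parent (□-symmetric symX symY) (inj₁ (adj , refl)) mon)

  monitorsʸ⇒root-row : ∀ {p q q′} → Adj Y q q′ →
                       MonitoredBy (X □ Y) ((p , q) , (p , q′)) (a , b) → p ≡ a
  monitorsʸ⇒root-row adj mon = Sum.[ sole-parentʸ⇒root-row , sole-parentʸ⇒root-row ]
    (monitored⇒sole-parent (□-symmetric symX symY) (inj₂ (refl , adj)) mon)

  monitorsʸ⇒sole-parent : ∀ {p q q′} → Adj Y q q′ → MonitoredBy (X □ Y) ((p , q) , (p , q′)) (a , b) →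
                          SoleParentEdge Y g q q′
  monitorsʸ⇒sole-parent adj mon = Sum.map sole-parentʸ-proj sole-parentʸ-proj
    (monitored⇒sole-parent (□-symmetric symX symY) (inj₂ (refl , adj)) mon)

  sole-parentˣ⇒monitors : ∀ {p p′ b′} → SoleParentEdge X f p p′ → Adj Y b b′ → b ≢ b′ →
                          MonitoredBy (X □ Y) ((p , b) , (p′ , b)) (a , b)
  sole-parentˣ⇒monitors (inj₁ sole) bb′ b≢b′ =
    sole-parent⇒monitored (sole-parentˣ-lift sole) (detourˣ (proj₁ (proj₁ sole)) bb′ (symY bb′) b≢b′)
  sole-parentˣ⇒monitors (inj₂ sole) bb′ b≢b′ =
    MonitoredBy-swap (sole-parentˣ⇒monitors (inj₁ sole) bb′ b≢b′)

  sole-parentʸ⇒monitors : ∀ {q q′ a′} → SoleParentEdge Y g q q′ → Adj X a a′ → a ≢ a′ →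
                          MonitoredBy (X □ Y) ((a , q) , (a , q′)) (a , b)
  sole-parentʸ⇒monitors (inj₁ sole) aa′ a≢a′ =
    sole-parent⇒monitored (sole-parentʸ-lift sole) (detourʸ (proj₁ (proj₁ sole)) aa′ (symX aa′) a≢a′)
  sole-parentʸ⇒monitors (inj₂ sole) aa′ a≢a′ =
    MonitoredBy-swap (sole-parentʸ⇒monitors (inj₁ sole) aa′ a≢a′)

-- Paths

Consecutive : ℕ → ℕ → Set
Consecutive s t = suc s ≡ t ⊎ suc t ≡ s

∣-∣-step : ∀ a s → suc ∣ a - s ∣ ≡ ∣ a - suc s ∣ ⊎ suc ∣ a - suc s ∣ ≡ ∣ a - s ∣
∣-∣-step zero    s       = inj₁ refl
∣-∣-step (suc a) zero    = inj₂ (cong suc (∣-∣-identityʳ a))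
∣-∣-step (suc a) (suc s) = ∣-∣-step a s

∣-∣-oriented : ∀ a {s t} → Consecutive s t →
               suc ∣ a - s ∣ ≡ ∣ a - t ∣ ⊎ suc ∣ a - t ∣ ≡ ∣ a - s ∣
∣-∣-oriented a {s} (inj₁ refl)     = ∣-∣-step a s
∣-∣-oriented a {t = t} (inj₂ refl) = Sum.swap (∣-∣-step a t)

∣-∣-consecutive : ∀ a {s t} → Consecutive s t → ∣ a - t ∣ ≤ suc ∣ a - s ∣
∣-∣-consecutive a c with ∣-∣-oriented a c
... | inj₁ e = ≤-reflexive (sym e)
... | inj₂ e = ≤-trans (n≤1+n _) (≤-trans (≤-reflexive e) (n≤1+n _))

∣-∣-descent : ∀ {M} a t → a < M → t < M → t ≢ a →
              ∃ λ s → Consecutive s t × suc ∣ a - s ∣ ≡ ∣ a - t ∣ × s < M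
∣-∣-descent zero    zero    _   _   t≢a = ⊥-elim (t≢a refl)
∣-∣-descent zero    (suc t) _   t<M _   = t , inj₁ refl , refl , <-trans (n<1+n t) t<M
∣-∣-descent (suc a) zero    a<M _   _   =
  1 , inj₂ refl , cong suc (∣-∣-identityʳ a) , ≤-trans (s≤s (s≤s z≤n)) a<M
∣-∣-descent {suc M} (suc a) (suc t) (s≤s a<M) (s≤s t<M) t≢a
  with ∣-∣-descent a t a<M t<M (t≢a ∘ cong suc)
... | s , c , e , s<M = suc s , Sum.map (cong suc) (cong suc) c , e , s≤s s<M

∣-∣-no-two-descents : ∀ a t → suc ∣ a - t ∣ ≡ ∣ a - suc t ∣ →
                      suc ∣ a - suc (suc t) ∣ ≡ ∣ a - suc t ∣ → ⊥
∣-∣-no-two-descents zero    t       _ e  = 1+n≰n (≤-trans (n≤1+n _) (≤-reflexive (suc-injective e)))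
∣-∣-no-two-descents (suc a) zero    e _  =
  1+n≰n (≤-trans (n≤1+n _) (≤-reflexive (trans e (∣-∣-identityʳ a))))
∣-∣-no-two-descents (suc a) (suc t) e e′ = ∣-∣-no-two-descents a t e e′

∣-∣-sole-descent : ∀ a {s t u} → Consecutive s u → Consecutive t u →
                   suc ∣ a - s ∣ ≡ ∣ a - u ∣ → suc ∣ a - t ∣ ≡ ∣ a - u ∣ → t ≡ s
∣-∣-sole-descent a (inj₁ refl) (inj₁ e)    _  _  = suc-injective e
∣-∣-sole-descent a (inj₂ refl) (inj₂ refl) _  _  = refl
∣-∣-sole-descent a {s} (inj₁ refl) (inj₂ refl) es et = ⊥-elim (∣-∣-no-two-descents a s es et)
∣-∣-sole-descent a {t = t} (inj₂ refl) (inj₁ refl) es et = ⊥-elim (∣-∣-no-two-descents a t et es)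

module _ {m : ℕ} where

  pathDist : Fin m → Fin m → ℕ
  pathDist a i = ∣ toℕ a - toℕ i ∣

  path-symmetric : Symmetric (Adj (PathG m))
  path-symmetric = Sum.swap

  path-irreflexive : ∀ {i j} → Adj (PathG m) i j → i ≢ j
  path-irreflexive (inj₁ e) refl = 1+n≢n e
  path-irreflexive (inj₂ e) refl = 1+n≢n e

  path-searchable : Searchable (PathG m)
  path-searchable = record
    { _≟_  = Fin._≟_
    ; adj? = λ i j → (suc (toℕ i) ℕ.≟ toℕ j) ⊎-dec (suc (toℕ j) ℕ.≟ toℕ i)
    ; any? = λ _ → Fin.any?
    }

  path-labelling : ∀ a → IsDistanceLabelling (PathG m) a (pathDist a)
  path-labelling a = record
    { lipschitz = ∣-∣-consecutive (toℕ a) ; root = ∣n-n∣≡0 (toℕ a) ; parent = parent }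
    where
    parent : ∀ {i} → i ≢ a → ∃ λ j → IsParent (PathG m) (pathDist a) j i
    parent {i} i≢a with ∣-∣-descent (toℕ a) (toℕ i) (toℕ<n a) (toℕ<n i) (i≢a ∘ toℕ-injective)
    ... | s , c , e , s<m =
      fromℕ< s<m , subst (λ z → Consecutive z (toℕ i)) (sym (toℕ-fromℕ< s<m)) c ,
      trans (cong (λ z → suc ∣ toℕ a - z ∣) (toℕ-fromℕ< s<m)) e

  path-sole-parent : ∀ a {i j} → Adj (PathG m) i j → SoleParentEdge (PathG m) (pathDist a) i j
  path-sole-parent a c with ∣-∣-oriented (toℕ a) c
  ... | inj₁ e = inj₁ ((c , e) , λ (c′ , e′) → toℕ-injective (∣-∣-sole-descent (toℕ a) c c′ e e′))
  ... | inj₂ e = inj₂ ((path-symmetric c , e) , λ (c′ , e′) →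
                   toℕ-injective (∣-∣-sole-descent (toℕ a) (path-symmetric c) c′ e e′))

path-neighbour : ∀ {m} → 2 ≤ m → (i : Fin m) → ∃ λ j → Adj (PathG m) i j
path-neighbour (s≤s (s≤s _)) Fin.zero    = Fin.suc Fin.zero , inj₁ refl
path-neighbour _             (Fin.suc i) = inject₁ i , inj₂ (cong suc (toℕ-inject₁ i))

-- Cycles

∸-suc : ∀ {m n} → n < m → m ∸ n ≡ suc (m ∸ suc n)
∸-suc {suc m} {zero}  _         = refl
∸-suc {suc m} {suc n} (s≤s n<m) = ∸-suc n<m

⌊n/2⌋-parity : ∀ n → ⌊ n /2⌋ + ⌊ n /2⌋ ≡ n ⊎ suc (⌊ n /2⌋ + ⌊ n /2⌋) ≡ n
⌊n/2⌋-parity zero          = inj₁ refl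
⌊n/2⌋-parity (suc zero)    = inj₂ refl
⌊n/2⌋-parity (suc (suc n)) with ⌊n/2⌋-parity n
... | inj₁ e = inj₁ (trans (cong suc (+-suc ⌊ n /2⌋ ⌊ n /2⌋)) (cong (suc ∘ suc) e))
... | inj₂ e = inj₂ (cong suc (trans (cong suc (+-suc ⌊ n /2⌋ ⌊ n /2⌋)) (cong suc e)))

[m%n+k]%n≡[m+k]%n : ∀ m k n .{{_ : NonZero n}} → (m % n + k) % n ≡ (m + k) % n
[m%n+k]%n≡[m+k]%n m k n = begin
  (m % n + k) % n          ≡⟨ %-distribˡ-+ (m % n) k n ⟩
  (m % n % n + k % n) % n  ≡⟨ cong (λ z → (z + k % n) % n) (m%n%n≡m%n m n) ⟩
  (m % n + k % n) % n      ≡⟨ %-distribˡ-+ m k n ⟨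
  (m + k) % n              ∎
  where open ≡-Reasoning

[1+m%n]%n≡[1+m]%n : ∀ m n .{{_ : NonZero n}} → suc (m % n) % n ≡ suc m % n
[1+m%n]%n≡[1+m]%n m n = begin
  suc (m % n) % n   ≡⟨ cong (_% n) (+-comm 1 (m % n)) ⟩
  (m % n + 1) % n   ≡⟨ [m%n+k]%n≡[m+k]%n m 1 n ⟩
  (m + 1) % n       ≡⟨ cong (_% n) (+-comm m 1) ⟩
  suc m % n         ∎
  where open ≡-Reasoning

module Arc (k : ℕ) where

  N : ℕ
  N = suc (suc (suc k))

  Step : ℕ → ℕ → Set
  Step t t′ = suc t ≡ t′ ⊎ (suc t ≡ N × t′ ≡ 0)

  Step-functional : ∀ {t t′ t″} → t′ < N → t″ < N → Step t t′ → Step t t″ → t′ ≡ t″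
  Step-functional _   _   (inj₁ e)       (inj₁ e′)       = trans (sym e) e′
  Step-functional t′<N _  (inj₁ e)       (inj₂ (e′ , _)) = ⊥-elim (<-irrefl (trans (sym e) e′) t′<N)
  Step-functional _  t″<N (inj₂ (e , _)) (inj₁ e′)       = ⊥-elim (<-irrefl (trans (sym e′) e) t″<N)
  Step-functional _   _   (inj₂ (_ , e)) (inj₂ (_ , e′)) = trans e (sym e′)

  arc : ℕ → ℕ
  arc t = t ⊓ (N ∸ t)

  arc-short : ∀ {t} → t + t ≤ N → arc t ≡ t
  arc-short {t} le = m≤n⇒m⊓n≡m (m+n≤o⇒m≤o∸n t le)

  arc-long : ∀ {t} → N ≤ t + t → arc t ≡ N ∸ t
  arc-long {t} le = m≥n⇒m⊓n≡n (m≤n+o⇒m∸n≤o N t le)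

  arc-lipschitz : ∀ {t t′} → t < N → Step t t′ → arc t′ ≤ suc (arc t) × arc t ≤ suc (arc t′)
  arc-lipschitz {t} t<N (inj₁ refl) rewrite ∸-suc t<N = forward , backward
    where
    forward : suc t ⊓ (N ∸ suc t) ≤ suc (t ⊓ suc (N ∸ suc t))
    forward = ≤-trans (⊓-monoʳ-≤ (suc t) (n≤1+n _)) (s≤s (⊓-monoʳ-≤ t (n≤1+n _)))
    backward : t ⊓ suc (N ∸ suc t) ≤ suc (suc t ⊓ (N ∸ suc t))
    backward = ≤-trans (⊓-monoˡ-≤ _ (n≤1+n t)) (s≤s (⊓-monoˡ-≤ _ (n≤1+n t)))
  arc-lipschitz {t} _ (inj₂ (1+t≡N , refl)) =
    z≤n , ≤-trans (m⊓n≤n t (N ∸ t)) (≤-reflexive (trans (cong (_∸ t) (sym 1+t≡N)) (m+n∸n≡m 1 t)))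

  arc-descent : ∀ {t} → 0 < t → t < N →
                ∃ λ t′ → t′ < N × (Step t′ t ⊎ Step t t′) × suc (arc t′) ≡ arc t
  arc-descent {suc t} _ t<N with ≤-total (suc t + suc t) N
  ... | inj₁ short = t , <-trans (n<1+n t) t<N , inj₁ (inj₁ refl) ,
    trans (cong suc (arc-short (≤-trans (+-mono-≤ (n≤1+n t) (n≤1+n t)) short))) (sym (arc-short short))
  ... | inj₂ long with m≤n⇒m<n∨m≡n t<N
  ...   | inj₁ 2+t<N = suc (suc t) , 2+t<N , inj₂ (inj₁ refl) ,
    trans (cong suc (arc-long (≤-trans long (+-mono-≤ (n≤1+n (suc t)) (n≤1+n (suc t))))))
          (trans (sym (∸-suc t<N)) (sym (arc-long long)))
  ...   | inj₂ 1+t≡N = 0 , s≤s z≤n , inj₂ (inj₂ (1+t≡N , refl)) ,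
    sym (trans (arc-long long) (trans (cong (_∸ suc t) (sym 1+t≡N)) (m+n∸n≡m 1 (suc t))))

  Adjacent : ℕ → ℕ → Set
  Adjacent t t′ = Step t t′ ⊎ Step t′ t

  -- The edge t → t + 1 leads away from 0 along the shorter arc (Near) or towards 0 (Far);
  -- only the edges at the vertex antipodal to 0 are neither.
  Near Far : ℕ → Set
  Near t = suc t + suc t < N
  Far  t = N < t + t

  near-sole-parent : ∀ {t t′} → Near t → Step t t′ →
                     suc (arc t) ≡ arc t′ × (∀ {w} → Adjacent w t′ → suc (arc w) ≡ arc t′ → w ≡ t)
  near-sole-parent {t} near (inj₂ (1+t≡N , _)) =
    ⊥-elim (<⇒≱ near (subst (_≤ suc t + suc t) 1+t≡N (m≤m+n (suc t) (suc t))))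
  near-sole-parent {t} near (inj₁ refl) = trans (cong suc arc-t) (sym arc-1+t) , sole
    where
    arc-t : arc t ≡ t
    arc-t = arc-short (≤-trans (+-mono-≤ (n≤1+n t) (n≤1+n t)) (<⇒≤ near))
    arc-1+t : arc (suc t) ≡ suc t
    arc-1+t = arc-short (<⇒≤ near)
    sole : ∀ {w} → Adjacent w (suc t) → suc (arc w) ≡ arc (suc t) → w ≡ t
    sole (inj₁ (inj₁ e))        _ = suc-injective e
    sole (inj₂ (inj₁ refl))     e = ⊥-elim (1+n≰n (subst (suc t ≤_) (suc-injective (trans e arc-1+t))
      (⊓-glb (n≤1+n (suc t)) (m+n≤o⇒m≤o∸n (suc t) (subst (_≤ N) (sym (+-suc (suc t) (suc t))) near)))))
    sole (inj₂ (inj₂ (2+t≡N , _))) _ =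
      ⊥-elim (<⇒≱ near (subst (_≤ suc t + suc t) 2+t≡N (s≤s (m≤n+m (suc t) t))))

  far-sole-parent : ∀ {t t′} → Far t → t < N → t′ < N → Step t t′ →
                    suc (arc t′) ≡ arc t ×
                    (∀ {w} → w < N → Adjacent w t → suc (arc w) ≡ arc t → w ≡ t′)
  far-sole-parent {t} {t′} far t<N t′<N st = descends st , sole
    where
    descends : ∀ {t′} → Step t t′ → suc (arc t′) ≡ arc t
    descends (inj₁ refl) = trans (cong suc (arc-long (≤-trans (<⇒≤ far) (+-mono-≤ (n≤1+n t) (n≤1+n t)))))
                                 (trans (sym (∸-suc t<N)) (sym (arc-long (<⇒≤ far))))
    descends (inj₂ (1+t≡N , refl)) =
      sym (trans (arc-long (<⇒≤ far)) (trans (cong (_∸ t) (sym 1+t≡N)) (m+n∸n≡m 1 t)))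
    sole : ∀ {w} → w < N → Adjacent w t → suc (arc w) ≡ arc t → w ≡ t′
    sole w<N (inj₂ sw) _ = Step-functional w<N t′<N sw st
    sole {w} _ (inj₁ (inj₁ refl)) e =
      ⊥-elim (1+n≰n (≤-trans (subst (suc (arc w) ≤_) (arc-long (<⇒≤ far)) (≤-reflexive e))
                             (⊓-glb below shorter)))
      where
      below : N ∸ suc w ≤ w
      below = m≤n+o⇒m∸n≤o N (suc w) (≤-pred (subst (N <_) (+-suc (suc w) w) far))
      shorter : N ∸ suc w ≤ N ∸ w
      shorter = ∸-monoʳ-≤ N (n≤1+n w)
    sole _ (inj₁ (inj₂ (_ , refl))) _ = ⊥-elim (<⇒≱ far z≤n)

  h : ℕ
  h = ⌊ N /2⌋

  h+h≤N : h + h ≤ N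
  h+h≤N with ⌊n/2⌋-parity N
  ... | inj₁ e = ≤-reflexive e
  ... | inj₂ e = ≤-trans (n≤1+n _) (≤-reflexive e)

  N≤1+h+h : N ≤ suc (h + h)
  N≤1+h+h with ⌊n/2⌋-parity N
  ... | inj₁ e = ≤-trans (≤-reflexive (sym e)) (n≤1+n _)
  ... | inj₂ e = ≤-reflexive (sym e)

  1+h<N : suc h < N
  1+h<N = s≤s (s≤s (⌊n/2⌋<n k))

  h<N : h < N
  h<N = <-trans (n<1+n h) 1+h<N

  -- Why 0 does not monitor the antipodal edge: it is level when N is odd, and when N is even its
  -- endpoint h has the two parents h − 1 and h + 1.
  Balanced : ℕ → ℕ → Set
  Balanced t t′ = arc t ≡ arc t′ ⊎
    (suc (arc t′) ≡ arc t × ∃ λ w → w < N × Step w t × w ≢ t′ × suc (arc w) ≡ arc t)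

  middle-balanced : Balanced h (suc h)
  middle-balanced with ⌊n/2⌋-parity N
  ... | inj₂ odd = inj₁ (trans (arc-short (≤-trans (n≤1+n _) (≤-reflexive odd)))
    (sym (trans (arc-long (subst (_≤ suc h + suc h) odd (s≤s (+-monoʳ-≤ h (n≤1+n h)))))
                (trans (cong (_∸ suc h) (sym odd)) (m+n∸n≡m h h)))))
  ... | inj₁ even = inj₂ (trans (cong suc (arc-long N≤2+2h)) (trans (sym (∸-suc h<N)) N∸h≡arc-h) ,
                          h′ , ≤-trans (n≤1+n _) h<N , inj₁ refl , (λ e → <-irrefl e (n≤1+n (suc h′))) ,
                          arc-pred-h)
    where
    -- h is definitionally suc h′, because N = suc (suc (suc k)).
    h′ : ℕ
    h′ = ⌊ suc k /2⌋
    N≤2+2h : N ≤ suc h + suc h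
    N≤2+2h = ≤-trans N≤1+h+h (s≤s (+-monoʳ-≤ h (n≤1+n h)))
    N∸h≡arc-h : N ∸ h ≡ arc h
    N∸h≡arc-h = trans (cong (_∸ h) (sym even)) (trans (m+n∸n≡m h h) (sym (arc-short h+h≤N)))
    arc-pred-h : suc (arc h′) ≡ arc h
    arc-pred-h = trans (cong suc (arc-short (≤-trans (+-mono-≤ (n≤1+n h′) (n≤1+n h′)) h+h≤N)))
                       (sym (arc-short h+h≤N))

  Near-or-Far? : ∀ t → Dec (Near t ⊎ Far t)
  Near-or-Far? t = (suc t + suc t <? N) ⊎-dec (N <? t + t)

  antipodal-cover : ∀ {s s′} → s′ + h ≡ s ⊎ s′ + h ≡ s + N →
                    (Near s ⊎ Far s) ⊎ (Near s′ ⊎ Far s′)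
  antipodal-cover {s} {s′} rel with Near-or-Far? s
  ... | yes nf = inj₁ nf
  ... | no ¬nf = inj₂ (other s′ rel)
    where
    long : N ≤ suc s + suc s
    long = ≮⇒≥ (¬nf ∘ inj₁)
    short : s + s ≤ N
    short = ≮⇒≥ (¬nf ∘ inj₂)
    other : ∀ s′ → s′ + h ≡ s ⊎ s′ + h ≡ s + N → Near s′ ⊎ Far s′
    other zero     (inj₁ _) = inj₁ (s≤s (s≤s (s≤s z≤n)))
    other (suc s″) (inj₁ e) = ⊥-elim (<⇒≱ beyond (≤-trans short N≤1+h+h))
      where
      beyond : suc (h + h) < s + s
      beyond = begin-strict
        suc (h + h)                   <⟨ +-monoˡ-≤ (h + h) (s≤s (≤-trans (s≤s z≤n) (m≤n+m (suc s″) s″))) ⟩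
        (suc s″ + suc s″) + (h + h)   ≡⟨ interchange (suc s″) h (suc s″) h ⟨
        (suc s″ + h) + (suc s″ + h)   ≡⟨ cong (λ z → z + z) e ⟩
        s + s                         ∎
        where open ≤-Reasoning
    other s′ (inj₂ e) with N <? s′ + s′
    ... | yes far = inj₂ far
    ... | no ¬far = ⊥-elim (<⇒≱ (s≤s (s≤s (s≤s z≤n))) (subst (λ z → N ≤ suc z + suc z) s≡0 long))
      where
      2s≤0 : s + s ≤ 0
      2s≤0 = +-cancelʳ-≤ (N + N) (s + s) 0 (begin
        (s + s) + (N + N)   ≡⟨ interchange s N s N ⟨
        (s + N) + (s + N)   ≡⟨ cong (λ z → z + z) e ⟨
        (s′ + h) + (s′ + h) ≡⟨ interchange s′ h s′ h ⟩
        (s′ + s′) + (h + h) ≤⟨ +-mono-≤ (≮⇒≥ ¬far) h+h≤N ⟩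
        N + N               ∎)
        where open ≤-Reasoning
      s≡0 : s ≡ 0
      s≡0 = m+n≡0⇒m≡0 s (n≤0⇒n≡0 2s≤0)

module Cycle (k : ℕ) where
  open Arc k

  C : Graph
  C = CycleG N

  -- Adj C i j unfolds to toℕ i ↝ toℕ j ⊎ toℕ j ↝ toℕ i.
  _↝_ : ℕ → ℕ → Set
  t ↝ t′ = suc t % N ≡ t′

  ↝⇒Step : ∀ {t t′} → t < N → t ↝ t′ → Step t t′
  ↝⇒Step {t} t<N t↝t′ with m≤n⇒m<n∨m≡n t<N
  ... | inj₁ 1+t<N = inj₁ (trans (sym (m<n⇒m%n≡m 1+t<N)) t↝t′)
  ... | inj₂ 1+t≡N = inj₂ (1+t≡N , trans (sym t↝t′) (trans (cong (_% N) 1+t≡N) (n%n≡0 N)))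

  Step⇒↝ : ∀ {t t′} → t′ < N → Step t t′ → t ↝ t′
  Step⇒↝ t′<N (inj₁ refl)          = m<n⇒m%n≡m t′<N
  Step⇒↝ _    (inj₂ (1+t≡N , refl)) = trans (cong (_% N) 1+t≡N) (n%n≡0 N)

  adj⇒Adjacent : ∀ {i j} → Adj C i j → Adjacent (toℕ i) (toℕ j)
  adj⇒Adjacent {i} {j} = Sum.map (↝⇒Step (toℕ<n i)) (↝⇒Step (toℕ<n j))

  cycle-symmetric : Symmetric (Adj C)
  cycle-symmetric = Sum.swap

  cycle-irreflexive : ∀ {i j} → Adj C i j → i ≢ j
  cycle-irreflexive {i} a refl with ↝⇒Step (toℕ<n i) (Sum.reduce a)
  ... | inj₁ e       = 1+n≢n e
  ... | inj₂ (e , z) = contradiction (trans (cong suc (sym z)) e) λ ()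

  cycle-searchable : Searchable C
  cycle-searchable = record
    { _≟_  = Fin._≟_
    ; adj? = λ i j → (suc (toℕ i) % N ℕ.≟ toℕ j) ⊎-dec (suc (toℕ j) % N ℕ.≟ toℕ i)
    ; any? = λ _ → Fin.any?
    }

  cycle-neighbour : ∀ i → ∃ λ j → Adj C i j
  cycle-neighbour i = suc (toℕ i) mod N , inj₁ (sym (toℕ-fromℕ< _))

  rotate : ℕ → Fin N → Fin N
  rotate c j = (toℕ j + c) mod N

  toℕ-rotate : ∀ c j → toℕ (rotate c j) ≡ (toℕ j + c) % N
  toℕ-rotate c j = toℕ-fromℕ< _

  rotate-↝ : ∀ c {i j} → toℕ i ↝ toℕ j → toℕ (rotate c i) ↝ toℕ (rotate c j)
  rotate-↝ c {i} {j} i↝j = begin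
    suc (toℕ (rotate c i)) % N   ≡⟨ cong (λ z → suc z % N) (toℕ-rotate c i) ⟩
    suc ((toℕ i + c) % N) % N    ≡⟨ [1+m%n]%n≡[1+m]%n (toℕ i + c) N ⟩
    (suc (toℕ i) + c) % N        ≡⟨ [m%n+k]%n≡[m+k]%n (suc (toℕ i)) c N ⟨
    (suc (toℕ i) % N + c) % N    ≡⟨ cong (λ z → (z + c) % N) i↝j ⟩
    (toℕ j + c) % N              ≡⟨ toℕ-rotate c j ⟨
    toℕ (rotate c j)             ∎
    where open ≡-Reasoning

  rotate-adj : ∀ c {i j} → Adj C i j → Adj C (rotate c i) (rotate c j)
  rotate-adj c {i} {j} = Sum.map (rotate-↝ c {i} {j}) (rotate-↝ c {j} {i})

  rotate-rotate : ∀ c c′ j → rotate c (rotate c′ j) ≡ rotate (c′ + c) j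
  rotate-rotate c c′ j = toℕ-injective (begin
    toℕ (rotate c (rotate c′ j))   ≡⟨ toℕ-rotate c (rotate c′ j) ⟩
    (toℕ (rotate c′ j) + c) % N    ≡⟨ cong (λ z → (z + c) % N) (toℕ-rotate c′ j) ⟩
    ((toℕ j + c′) % N + c) % N     ≡⟨ [m%n+k]%n≡[m+k]%n (toℕ j + c′) c N ⟩
    (toℕ j + c′ + c) % N           ≡⟨ cong (_% N) (+-assoc (toℕ j) c′ c) ⟩
    (toℕ j + (c′ + c)) % N         ≡⟨ toℕ-rotate (c′ + c) j ⟨
    toℕ (rotate (c′ + c) j)        ∎)
    where open ≡-Reasoning

  rotate-N : ∀ j → rotate N j ≡ j
  rotate-N j = toℕ-injective
    (trans (toℕ-rotate N j) (trans ([m+n]%n≡m%n (toℕ j) N) (m<n⇒m%n≡m (toℕ<n j))))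

  rotation : Fin N → Automorphism C
  rotation b = record
    { to       = rotate (N ∸ toℕ b)
    ; from     = rotate (toℕ b)
    ; from-to  = λ j → trans (rotate-rotate _ _ j) (trans (cong (λ c → rotate c j) (m∸n+n≡m b≤N))
                                                         (rotate-N j))
    ; to-from  = λ j → trans (rotate-rotate _ _ j) (trans (cong (λ c → rotate c j) (m+[n∸m]≡n b≤N))
                                                         (rotate-N j))
    ; to-adj   = rotate-adj _
    ; from-adj = rotate-adj _
    }
    where
    b≤N : toℕ b ≤ N
    b≤N = <⇒≤ (toℕ<n b)

  rotation-root : ∀ b → Automorphism.to (rotation b) b ≡ Fin.zero
  rotation-root b = toℕ-injective (trans (toℕ-rotate _ b)
    (trans (cong (_% N) (m+[n∸m]≡n (<⇒≤ (toℕ<n b)))) (n%n≡0 N)))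

  at : ∀ {t} → t < N → ∃ λ i → toℕ i ≡ t
  at t<N = fromℕ< t<N , toℕ-fromℕ< t<N

  Adjacent⇒adj : ∀ {i j} → Adjacent (toℕ i) (toℕ j) → Adj C i j
  Adjacent⇒adj {i} {j} = Sum.map (Step⇒↝ (toℕ<n j)) (Step⇒↝ (toℕ<n i))

  arc₀ : Fin N → ℕ
  arc₀ = arc ∘ toℕ

  cycle₀-labelling : IsDistanceLabelling C Fin.zero arc₀
  cycle₀-labelling = record { lipschitz = lipschitz ; root = refl ; parent = parent }
    where
    lipschitz : Lipschitz C arc₀
    lipschitz {i} {j} (inj₁ i↝j) = proj₁ (arc-lipschitz (toℕ<n i) (↝⇒Step (toℕ<n i) i↝j))
    lipschitz {i} {j} (inj₂ j↝i) = proj₂ (arc-lipschitz (toℕ<n j) (↝⇒Step (toℕ<n j) j↝i))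
    parent : ∀ {j} → j ≢ Fin.zero → ∃ λ i → IsParent C arc₀ i j
    parent {j} j≢0 with arc-descent (n≢0⇒n>0 (j≢0 ∘ toℕ-injective)) (toℕ<n j)
    ... | t , t<N , adj , e with at t<N
    ...   | i , refl = i , Adjacent⇒adj adj , e

  cycle₀-sole-parent : ∀ {i j} → toℕ i ↝ toℕ j → Near (toℕ i) ⊎ Far (toℕ i) →
                       SoleParentEdge C arc₀ i j
  cycle₀-sole-parent {i} i↝j (inj₁ near) with near-sole-parent near (↝⇒Step (toℕ<n i) i↝j)
  ... | e , sole = inj₁ ((inj₁ i↝j , e) , λ (aw , ew) → toℕ-injective (sole (adj⇒Adjacent aw) ew))
  cycle₀-sole-parent {i} {j} i↝j (inj₂ far)
    with far-sole-parent far (toℕ<n i) (toℕ<n j) (↝⇒Step (toℕ<n i) i↝j)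
  ... | e , sole = inj₂ ((inj₂ i↝j , e) , λ {w} (aw , ew) →
    toℕ-injective (sole (toℕ<n w) (adj⇒Adjacent aw) ew))

  cycle₀-balanced-edge : ∃₂ λ i j → Adj C i j × ¬ SoleParent C arc₀ i j × ¬ SoleParent C arc₀ j i
  cycle₀-balanced-edge with at h<N | at 1+h<N
  ... | i , ti | j , tj =
    i , j , Adjacent⇒adj (inj₁ (inj₁ (trans (cong suc ti) (sym tj)))) , unbalanced middle-balanced
    where
    unbalanced : Balanced h (suc h) → ¬ SoleParent C arc₀ i j × ¬ SoleParent C arc₀ j i
    unbalanced (inj₁ level) =
      (λ ((_ , e) , _) → 1+n≢n (trans (cong (suc ∘ arc) (sym ti)) (trans e (trans (cong arc tj) (sym level))))) ,
      (λ ((_ , e) , _) → 1+n≢n (trans (cong (suc ∘ arc) (sym tj)) (trans e (trans (cong arc ti) level))))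
    unbalanced (inj₂ (descends , w , w<N , sw , w≢1+h , ew)) with at w<N
    ... | w′ , refl =
      (λ ((_ , e) , _) → <-asym (≤-reflexive (trans (cong (suc ∘ arc) (sym ti)) (trans e (cong arc tj))))
                                (≤-reflexive descends)) ,
      (λ (_ , sole) → w≢1+h (trans (cong toℕ (sole (Adjacent⇒adj (inj₁ (subst (Step w) (sym ti) sw)) ,
                                                    trans ew (cong arc (sym ti))))) tj))

  cycleDist : Fin N → Fin N → ℕ
  cycleDist b = arc₀ ∘ Automorphism.to (rotation b)

  cycle-labelling : ∀ b → IsDistanceLabelling C b (cycleDist b)
  cycle-labelling b = labelling-∘ (rotation b) (rotation-root b) cycle₀-labelling

  cycle-balanced-edge : ∀ b → ∃₂ λ i j → Adj C i j × ¬ SoleParent C (cycleDist b) i j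
                                                     × ¬ SoleParent C (cycleDist b) j i
  cycle-balanced-edge b with cycle₀-balanced-edge
  ... | i , j , a , ¬ij , ¬ji = from i , from j , from-adj a , ¬ij ∘ back , ¬ji ∘ back
    where
    open Automorphism (rotation b)
    back : ∀ {c d} → SoleParent C (cycleDist b) (from c) (from d) → SoleParent C arc₀ c d
    back = subst₂ (SoleParent C arc₀) (to-from _) (to-from _) ∘ sole-parent-∘⁻ (rotation b)

  position : Fin N → Fin N → ℕ
  position b i = toℕ (Automorphism.to (rotation b) i)

  cycle-sole-parent : ∀ b {i j} → toℕ i ↝ toℕ j → Near (position b i) ⊎ Far (position b i) →
                      SoleParentEdge C (cycleDist b) i j
  cycle-sole-parent b {i} {j} i↝j nf = Sum.map (sole-parent-∘ (rotation b)) (sole-parent-∘ (rotation b))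
    (cycle₀-sole-parent (rotate-↝ (N ∸ toℕ b) {i} {j} i↝j) nf)

  %-wrap : ∀ {x} → x < N + N → x ≡ x % N ⊎ x ≡ x % N + N
  %-wrap {x} x<2N with x <? N
  ... | yes x<N = inj₁ (sym (m<n⇒m%n≡m x<N))
  ... | no  x≮N = inj₂ (begin
    x                ≡⟨ m∸n+n≡m (≮⇒≥ x≮N) ⟨
    x ∸ N + N        ≡⟨ cong (_+ N) (m<n⇒m%n≡m (m<n+o⇒m∸n<o x N x<2N)) ⟨
    (x ∸ N) % N + N  ≡⟨ cong (_+ N) ([m+n]%n≡m%n (x ∸ N) N) ⟨
    (x ∸ N + N) % N + N ≡⟨ cong (λ z → z % N + N) (m∸n+n≡m (≮⇒≥ x≮N)) ⟩
    x % N + N        ∎)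
    where open ≡-Reasoning

  antipodal-positions : ∀ {b b′} → toℕ b′ ≡ toℕ b + h → ∀ i →
                        position b′ i + h ≡ position b i ⊎ position b′ i + h ≡ position b i + N
  antipodal-positions {b} {b′} b′≡b+h i =
    subst (λ s → position b′ i + h ≡ s ⊎ position b′ i + h ≡ s + N) s≡[s′+h]%N
          (%-wrap (+-mono-< (toℕ<n (Automorphism.to (rotation b′) i)) h<N))
    where
    open ≡-Reasoning
    h+b≤N : h + toℕ b ≤ N
    h+b≤N = subst (_≤ N) (trans b′≡b+h (+-comm (toℕ b) h)) (<⇒≤ (toℕ<n b′))
    c′+h≡c : (N ∸ toℕ b′) + h ≡ N ∸ toℕ b
    c′+h≡c = begin
      (N ∸ toℕ b′) + h          ≡⟨ cong (λ z → (N ∸ z) + h) b′≡b+h ⟩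
      (N ∸ (toℕ b + h)) + h     ≡⟨ cong (_+ h) (∸-+-assoc N (toℕ b) h) ⟨
      (N ∸ toℕ b ∸ h) + h       ≡⟨ m∸n+n≡m (m+n≤o⇒m≤o∸n h h+b≤N) ⟩
      N ∸ toℕ b                 ∎
    s≡[s′+h]%N : (position b′ i + h) % N ≡ position b i
    s≡[s′+h]%N = begin
      (position b′ i + h) % N               ≡⟨ cong (λ z → (z + h) % N) (toℕ-rotate _ i) ⟩
      ((toℕ i + (N ∸ toℕ b′)) % N + h) % N  ≡⟨ [m%n+k]%n≡[m+k]%n (toℕ i + (N ∸ toℕ b′)) h N ⟩
      (toℕ i + (N ∸ toℕ b′) + h) % N        ≡⟨ cong (_% N) (+-assoc (toℕ i) _ h) ⟩
      (toℕ i + ((N ∸ toℕ b′) + h)) % N      ≡⟨ cong (λ z → (toℕ i + z) % N) c′+h≡c ⟩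
      (toℕ i + (N ∸ toℕ b)) % N             ≡⟨ toℕ-rotate _ i ⟨
      position b i                          ∎

  cycle-cover : ∀ {b b′} → toℕ b′ ≡ toℕ b + h → ∀ {i j} → Adj C i j →
                SoleParentEdge C (cycleDist b) i j ⊎ SoleParentEdge C (cycleDist b′) i j
  cycle-cover {b} {b′} b′≡b+h {i} {j} (inj₁ i↝j) =
    Sum.map (cycle-sole-parent b i↝j) (cycle-sole-parent b′ i↝j)
            (antipodal-cover (antipodal-positions b′≡b+h i))
  cycle-cover b′≡b+h (inj₂ j↝i) = Sum.map Sum.swap Sum.swap (cycle-cover b′≡b+h (inj₁ j↝i))


-- The product of a path and a cycle

injection⇒≤length : ∀ {A : Set} {K} (xs : List A) (g : Fin K → A) →
                    (∀ {p q} → g p ≡ g q → p ≡ q) → (∀ p → g p ∈ xs) → K ≤ length xs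
injection⇒≤length xs g g-injective g∈xs = injective⇒≤ {f = index ∘ g∈xs} λ {p} {q} e →
  g-injective (trans (lookup-index (g∈xs p)) (trans (cong (lookup xs) e) (sym (lookup-index (g∈xs q)))))

splitAt-injective : ∀ {A : Set} m {n} {g : Fin m ⊎ Fin n → A} → (∀ {x y} → g x ≡ g y → x ≡ y) →
                    ∀ {p q} → g (splitAt m p) ≡ g (splitAt m q) → p ≡ q
splitAt-injective m {n} g-injective {p} {q} e =
  trans (sym (join-splitAt m n p)) (trans (cong (join m n) (g-injective e)) (join-splitAt m n q))

module PathCycle (m′ k : ℕ) where
  open Arc k using (N; h; h<N; h+h≤N; N≤1+h+h)
  open Cycle k

  m : ℕ
  m = suc (suc m′)

  G : Graph
  G = PathG m □ C

  module Root (y : V G) = Product path-searchable cycle-searchable path-symmetric cycle-symmetric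
                                  (path-labelling (proj₁ y)) (cycle-labelling (proj₂ y))

  column-bound : ∀ M → IsDEM G M → N ≤ length M
  column-bound M dem = injection⇒≤length M (proj₁ ∘ watcher) watcher-injective (proj₁ ∘ proj₂ ∘ watcher)
    where
    edge : ∃ λ p → Adj (PathG m) Fin.zero p
    edge = path-neighbour (s≤s (s≤s z≤n)) Fin.zero
    watcher : ∀ j → ∃ λ y → y ∈ M × proj₂ y ≡ j
    watcher j with dem (Fin.zero , j) (proj₁ edge , j) (inj₁ (proj₂ edge , refl))
    ... | y , y∈M , mon = y , y∈M , sym (Root.monitorsˣ⇒root-column y (proj₂ edge) mon)
    watcher-injective : ∀ {j j′} → proj₁ (watcher j) ≡ proj₁ (watcher j′) → j ≡ j′
    watcher-injective {j} {j′} e =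
      trans (sym (proj₂ (proj₂ (watcher j)))) (trans (cong proj₂ e) (proj₂ (proj₂ (watcher j′))))

  record RowPair (i : Fin m) : Set where
    field
      left right : V G
      left-row   : proj₁ left ≡ i
      right-row  : proj₁ right ≡ i
      left≢right : left ≢ right
  open RowPair

  pair : (∀ i → RowPair i) → Fin m ⊎ Fin m → V G
  pair P (inj₁ i) = left (P i)
  pair P (inj₂ i) = right (P i)

  pick : (∀ i → RowPair i) → Fin (m + m) → V G
  pick P = pair P ∘ splitAt m

  pick-injective : ∀ P {x y} → pick P x ≡ pick P y → x ≡ y
  pick-injective P = splitAt-injective m λ {x} {y} e →
    pair-injective x y e (trans (sym (row x)) (trans (cong proj₁ e) (row y)))
    where
    row : ∀ x → proj₁ (pair P x) ≡ Sum.reduce x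
    row (inj₁ i) = left-row (P i)
    row (inj₂ i) = right-row (P i)
    pair-injective : ∀ x y → pair P x ≡ pair P y → Sum.reduce x ≡ Sum.reduce y → x ≡ y
    pair-injective (inj₁ i) (inj₁ _) _ refl = refl
    pair-injective (inj₂ i) (inj₂ _) _ refl = refl
    pair-injective (inj₁ i) (inj₂ _) e refl = ⊥-elim (left≢right (P i) e)
    pair-injective (inj₂ i) (inj₁ _) e refl = ⊥-elim (left≢right (P i) (sym e))

  pick-∈ : ∀ {M} P → (∀ i → left (P i) ∈ M) → (∀ i → right (P i) ∈ M) → ∀ x → pick P x ∈ M
  pick-∈ P left∈M right∈M x with splitAt m x
  ... | inj₁ i = left∈M i
  ... | inj₂ i = right∈M i

  m+m≡2*m : m + m ≡ 2 * m
  m+m≡2*m = cong (m +_) (sym (+-identityʳ m))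

  row-bound : ∀ M → IsDEM G M → 2 * m ≤ length M
  row-bound M dem = subst (_≤ length M) m+m≡2*m
    (injection⇒≤length M (pick (proj₁ ∘ watchers)) (pick-injective (proj₁ ∘ watchers))
      (pick-∈ (proj₁ ∘ watchers) (proj₁ ∘ proj₂ ∘ watchers) (proj₂ ∘ proj₂ ∘ watchers)))
    where
    edge : ∃ λ j → Adj C Fin.zero j
    edge = cycle-neighbour Fin.zero
    watchers : ∀ i → Σ (RowPair i) λ P → left P ∈ M × right P ∈ M
    watchers i with dem (i , Fin.zero) (i , proj₁ edge) (inj₂ (refl , proj₂ edge))
    ... | y , y∈M , mon with Root.monitorsʸ⇒root-row y (proj₂ edge) mon | cycle-balanced-edge (proj₂ y)
    ... | refl | j , j′ , a , ¬jj′ , ¬j′j with dem (proj₁ y , j) (proj₁ y , j′) (inj₂ (refl , a))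
    ... | y′ , y′∈M , mon′ = record
      { left = y ; right = y′ ; left-row = refl ; right-row = sym (Root.monitorsʸ⇒root-row y′ a mon′)
      ; left≢right = λ { refl → Sum.[ ¬jj′ , ¬j′j ] (Root.monitorsʸ⇒sole-parent y a mon′) }
      } , y∈M , y′∈M

  ColumnCover : List (V G) → Set
  ColumnCover M = ∀ j → ∃ λ y → y ∈ M × proj₂ y ≡ j

  AntipodalRows : List (V G) → Set
  AntipodalRows M = ∀ i → ∃₂ λ β γ → toℕ γ ≡ toℕ β + h × (i , β) ∈ M × (i , γ) ∈ M

  covers⇒DEM : ∀ M → ColumnCover M → AntipodalRows M → IsDEM G M
  covers⇒DEM M cols rows (p , q) (p′ , _) (inj₁ (adj , refl)) with cols q
  ... | (r , _) , y∈M , refl = (r , q) , y∈M ,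
    Root.sole-parentˣ⇒monitors (r , q) (path-sole-parent r adj) (proj₂ (cycle-neighbour q))
                               (cycle-irreflexive (proj₂ (cycle-neighbour q)))
  covers⇒DEM M cols rows (p , q) (_ , q′) (inj₂ (refl , adj)) with rows p
  ... | β , γ , γ≡β+h , β∈M , γ∈M = Sum.[ watch β∈M , watch γ∈M ] (cycle-cover γ≡β+h adj)
    where
    neighbour : ∃ λ p′ → Adj (PathG m) p p′
    neighbour = path-neighbour (s≤s (s≤s z≤n)) p
    watch : ∀ {b} → (p , b) ∈ M → SoleParentEdge C (cycleDist b) q q′ →
            ∃ λ y → y ∈ M × MonitoredBy G ((p , q) , (p , q′)) y
    watch {b} y∈M sole = (p , b) , y∈M ,
      Root.sole-parentʸ⇒monitors (p , b) sole (proj₂ neighbour) (path-irreflexive (proj₂ neighbour))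

  2m+1≡1+m+m : 2 * m + 1 ≡ suc (m + m)
  2m+1≡1+m+m = trans (+-comm (2 * m) 1) (cong suc (sym m+m≡2*m))

  -- Row i holds the columns i and i + h.
  column-vertex : Fin N → V G
  column-vertex j = (toℕ j % h) mod m , j

  large-cycle-rows : 2 * m + 1 ≤ N → AntipodalRows (tabulate column-vertex)
  large-cycle-rows 2m+1≤N i =
    fromℕ< i<N , fromℕ< i+h<N , trans (toℕ-fromℕ< i+h<N) (cong (_+ h) (sym (toℕ-fromℕ< i<N))) ,
    in-row (fromℕ< i<N) (trans (cong (_% h) (toℕ-fromℕ< i<N)) (m<n⇒m%n≡m i<h)) ,
    in-row (fromℕ< i+h<N)
      (trans (cong (_% h) (toℕ-fromℕ< i+h<N)) (trans ([m+n]%n≡m%n (toℕ i) h) (m<n⇒m%n≡m i<h)))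
    where
    m≤h : m ≤ h
    m≤h = ≮⇒≥ λ h<m → <⇒≱ (+-mono-< h<m h<m)
      (≤-pred (≤-trans (≤-reflexive (sym 2m+1≡1+m+m)) (≤-trans 2m+1≤N N≤1+h+h)))
    i<h : toℕ i < h
    i<h = <-≤-trans (toℕ<n i) m≤h
    i<N : toℕ i < N
    i<N = <-trans i<h h<N
    i+h<N : toℕ i + h < N
    i+h<N = <-≤-trans (+-monoˡ-< h i<h) h+h≤N
    in-row : ∀ j → toℕ j % h ≡ toℕ i → (i , j) ∈ tabulate column-vertex
    in-row j e = subst (_∈ tabulate column-vertex)
      (cong (_, j) (toℕ-injective (trans (toℕ-fromℕ< _) (trans (cong (_% m) e) (m<n⇒m%n≡m (toℕ<n i))))))
      (∈-tabulate⁺ {f = column-vertex} j)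

  dem-large-cycle : 2 * m + 1 ≤ N → DemIs G N
  dem-large-cycle 2m+1≤N =
    (M , tabulate⁺ {f = column-vertex} (cong proj₂) , covers⇒DEM M columns (large-cycle-rows 2m+1≤N) ,
     length-tabulate column-vertex) ,
    λ M′ _ → column-bound M′
    where
    M : List (V G)
    M = tabulate column-vertex
    columns : ColumnCover M
    columns j = column-vertex j , ∈-tabulate⁺ {f = column-vertex} j , refl

  H : ℕ
  H = ⌈ N /2⌉

  h+H≡N : h + H ≡ N
  h+H≡N = ⌊n/2⌋+⌈n/2⌉≡n N

  -- Row i holds the columns β i and β i + h: the columns below H occur as β i, the others as β i + h.
  β γ : Fin m → Fin N
  β i = fromℕ< (<-≤-trans (m%n<n (toℕ i) H) (⌈n/2⌉≤n N))
  γ i = fromℕ< (subst (toℕ (β i) + h <_) (trans (+-comm H h) h+H≡N) (+-monoˡ-< h β<H))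
    where
    β<H : toℕ (β i) < H
    β<H = subst (_< H) (sym (toℕ-fromℕ< _)) (m%n<n (toℕ i) H)

  toℕ-γ : ∀ i → toℕ (γ i) ≡ toℕ (β i) + h
  toℕ-γ i = toℕ-fromℕ< _

  antipodal-pair : ∀ i → RowPair i
  antipodal-pair i = record
    { left = i , β i ; right = i , γ i ; left-row = refl ; right-row = refl
    ; left≢right = λ e →
        m+1+n≰m (toℕ (β i)) (≤-reflexive (trans (sym (toℕ-γ i)) (cong (toℕ ∘ proj₂) (sym e))))
    }

  pair-∈ : ∀ x → pair antipodal-pair x ∈ tabulate (pick antipodal-pair)
  pair-∈ x = subst (λ z → pair antipodal-pair z ∈ tabulate (pick antipodal-pair)) (splitAt-join m m x)
                   (∈-tabulate⁺ {f = pick antipodal-pair} (join m m x))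

  H≤m : N < 2 * m + 1 → H ≤ m
  H≤m N<2m+1 = ≤-trans (⌈n/2⌉-mono (≤-pred (≤-trans N<2m+1 (≤-reflexive 2m+1≡1+m+m))))
                       (≤-reflexive (sym (n≡⌈n+n/2⌉ m)))

  small-cycle-columns : N < 2 * m + 1 → ColumnCover (tabulate (pick antipodal-pair))
  small-cycle-columns N<2m+1 j with toℕ j <? H
  ... | yes j<H = pair antipodal-pair (inj₁ i) , pair-∈ (inj₁ i) ,
    toℕ-injective (trans (toℕ-fromℕ< _) (trans (cong (_% H) (toℕ-fromℕ< j<m)) (m<n⇒m%n≡m j<H)))
    where
    j<m : toℕ j < m
    j<m = <-≤-trans j<H (H≤m N<2m+1)
    i : Fin m
    i = fromℕ< j<m
  ... | no j≮H = pair antipodal-pair (inj₂ i) , pair-∈ (inj₂ i) , toℕ-injective (begin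
    toℕ (γ i)            ≡⟨ toℕ-γ i ⟩
    toℕ (β i) + h        ≡⟨ cong (_+ h) (toℕ-fromℕ< _) ⟩
    toℕ i % H + h        ≡⟨ cong (λ z → z % H + h) (toℕ-fromℕ< j∸h<m) ⟩
    (toℕ j ∸ h) % H + h  ≡⟨ cong (_+ h) (m<n⇒m%n≡m j∸h<H) ⟩
    toℕ j ∸ h + h        ≡⟨ m∸n+n≡m (≤-trans (⌊n/2⌋≤⌈n/2⌉ N) (≮⇒≥ j≮H)) ⟩
    toℕ j                ∎)
    where
    open ≡-Reasoning
    j∸h<H : toℕ j ∸ h < H
    j∸h<H = m<n+o⇒m∸n<o (toℕ j) h (subst (toℕ j <_) (sym h+H≡N) (toℕ<n j))
    j∸h<m : toℕ j ∸ h < m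
    j∸h<m = <-≤-trans j∸h<H (H≤m N<2m+1)
    i : Fin m
    i = fromℕ< j∸h<m

  dem-small-cycle : N < 2 * m + 1 → DemIs G (2 * m)
  dem-small-cycle N<2m+1 =
    (M , tabulate⁺ {f = pick antipodal-pair} (pick-injective antipodal-pair) ,
     covers⇒DEM M (small-cycle-columns N<2m+1) rows ,
     trans (length-tabulate (pick antipodal-pair)) m+m≡2*m) ,
    λ M′ _ → row-bound M′
    where
    M : List (V G)
    M = tabulate (pick antipodal-pair)
    rows : AntipodalRows M
    rows i = β i , γ i , toℕ-γ i , pair-∈ (inj₁ i) , pair-∈ (inj₂ i)

mainTheorem14 : ∀ (m n : ℕ) → 2 ≤ m → 3 ≤ n →
    ((2 * m + 1 ≤ n → DemIs (PathG m □ CycleG n) n)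
     × (n < 2 * m + 1 → DemIs (PathG m □ CycleG n) (2 * m)))
mainTheorem14 _ _ (s≤s (s≤s {n = m′} _)) (s≤s (s≤s (s≤s {n = k} _))) =
  dem-large-cycle , dem-small-cycle
  where open PathCycle m′ k
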